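{- Let $k,l$ be positive integers, let $a_1,\ldots,a_k,b_1,\ldots,b_l\in\mathbb{Z}$, and let $n_1,\ldots,n_k\in\mathbb{Z}^+$ be pairwise distinct and $m_1,\ldots,m_l\in\mathbb{Z}^+$ be pairwise distinct. Let $A=\{a_s(n_s)\}_{s=1}^k$ and $B=\{b_t(m_t)\}_{t=1}^l$, with covering functions $w_A(x)=|\{1\leqslant s\leqslant k: x\equiv a_s\ (\mathrm{mod}\ n_s)\}|$ and $w_B(x)=|\{1\leqslant t\leqslant l: x\equiv b_t\ (\mathrm{mod}\ m_t)\}|$. Let $N=[n_1,\ldots,n_k,m_1,\ldots,m_l]$ be the least common multiple of all these moduli, and let $m$ be an integer that does not divide $N$. If $w_A(x)\equiv w_B(x)\ (\mathrm{mod}\ m)$ for all $x\in\mathbb{Z}$, then $A$ and $B$ are identical, i.e., $k=l$ and $\{a_s(n_s): 1\leqslant s\leqslant k\}=\{b_t(m_t):1\leqslant t\leqslant l\}$ as sets of residue classes.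
   Context: For $a\in\mathbb{Z}$ and $n\in\mathbb{Z}^+$, $a(n)$ denotes the residue class $\{x\in\mathbb{Z}: x\equiv a\ (\mathrm{mod}\ n)\}$. A congruence modulo $0$ means equality (so $m=0$ is allowed, as $0$ does not divide $N$). -}

module Defs where

open import Data.Nat as ℕ using (ℕ; zero; suc)
open import Data.Nat.LCM using (lcm)
import Data.Nat.Divisibility as ℕD
open import Data.Integer using (ℤ; _-_; ∣_∣)
open import Data.Fin using (Fin)
open import Data.Vec using (count; allFin)
open import Relation.Nullary using (Dec)

_∈RC_⟨_⟩ : ℤ → ℤ → ℕ → Set
x ∈RC a ⟨ n ⟩ = n ℕD.∣ ∣ x - a ∣

_∈RC?_⟨_⟩ : ∀ x a n → Dec (x ∈RC a ⟨ n ⟩)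
x ∈RC? a ⟨ n ⟩ = n ℕD.∣? ∣ x - a ∣

cover : ∀ {k} → (Fin k → ℤ) → (Fin k → ℕ) → ℤ → ℕ
cover {k} a n x = count (λ s → x ∈RC? a s ⟨ n s ⟩) (allFin k)

lcmFam : ∀ {k} → (Fin k → ℕ) → ℕ
lcmFam {zero}  f = 1
lcmFam {suc k} f = lcm (f Fin.zero) (lcmFam (λ i → f (Fin.suc i)))

{-# OPTIONS --safe #-}
-- Suppose the systems differ and let δ = w_A - w_B. Pairs of equal classes cancel in δ, which is
-- then a signed sum of the unmatched classes; let n be the largest unmatched modulus and N = K n.
-- With (S φ)(y) = φ (y + 1), the operator with integer coefficients
--   T = ∏ (1 - S^(n/p)) ∘ ∑_{j<K} S^(j n),   p ranging over the prime factors of n,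
-- preserves divisibility by m. The average makes the indicator of a class of modulus d ∣ N
-- periodic modulo gcd n d; for d ≤ n, d ≠ n this is a proper divisor of n, hence divides some n/p,
-- and 1 - S^(n/p) kills it. A class of modulus n is multiplied by K, and each system has at most
-- one unmatched class of modulus n. Comparing the p-parts of n, a suitable y gives (T δ) y = K v
-- with v ∈ {1, -1, 2} dividing n, so m ∣ K n = N.
module Submission where

module Sums where

  open import Data.Nat using (ℕ; zero; suc)
  open import Data.Integer using (ℤ; +_; _+_; _-_; _*_; 0ℤ; 1ℤ)
  open import Data.Integer.Properties using (+-*-semiring; +-identityˡ; +-identityʳ; *-identityˡ; *-zeroˡ)
  open import Data.Integer.Divisibility.Signed using (_∣_; ∣m∣n⇒∣m+n; ∣n⇒∣m*n; ∣-refl)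
  open import Data.Integer.Tactic.RingSolver using (solve-∀)
  open import Data.Fin using (Fin; zero; suc; punchIn; toℕ; fromℕ; inject₁)
  open import Data.Fin.Properties using (any?; punchInᵢ≢i; toℕ-inject₁; toℕ-fromℕ)
  open import Data.Vec using (count; tabulate)
  open import Data.Product using (_,_)
  open import Function.Bundles using (_⇔_; Equivalence)
  open import Function using (_∘_)
  open import Relation.Nullary using (Dec; yes; no; ¬_; ¬?; contradiction)
  open import Relation.Binary.PropositionalEquality
  open import Algebra.Properties.Semiring.Sum +-*-semiring public
    using (sum; sum-syntax; sum-cong-≗; sum-replicate-zero; sum-remove; sum-init-last; ∑-distrib-+; ∑-comm; *-distribˡ-sum)

  ⟦_⟧ : ∀ {a} {A : Set a} → Dec A → ℤ
  ⟦ yes _ ⟧ = 1ℤ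
  ⟦ no _ ⟧  = 0ℤ

  module _ {a} {A : Set a} where

    ⟦⟧-yes : (d : Dec A) → A → ⟦ d ⟧ ≡ 1ℤ
    ⟦⟧-yes (yes _) _  = refl
    ⟦⟧-yes (no ¬a) a = contradiction a ¬a

    ⟦⟧-no : (d : Dec A) → ¬ A → ⟦ d ⟧ ≡ 0ℤ
    ⟦⟧-no (yes a) ¬a = contradiction a ¬a
    ⟦⟧-no (no _) _   = refl

    ⟦⟧*-yes : (d : Dec A) → A → ∀ v → ⟦ d ⟧ * v ≡ v
    ⟦⟧*-yes d a v = trans (cong (_* v) (⟦⟧-yes d a)) (*-identityˡ v)

    ⟦⟧*-no : (d : Dec A) → ¬ A → ∀ v → ⟦ d ⟧ * v ≡ 0ℤ
    ⟦⟧*-no d ¬a v = trans (cong (_* v) (⟦⟧-no d ¬a)) (*-zeroˡ v)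

    ⟦⟧*-cong : (d : Dec A) {u v : ℤ} → (A → u ≡ v) → ⟦ d ⟧ * u ≡ ⟦ d ⟧ * v
    ⟦⟧*-cong (yes a) u≡v = cong (1ℤ *_) (u≡v a)
    ⟦⟧*-cong (no _)  _   = refl

    ⟦¬?⟧*+⟦⟧* : (d : Dec A) → ∀ v → ⟦ ¬? d ⟧ * v + ⟦ d ⟧ * v ≡ v
    ⟦¬?⟧*+⟦⟧* (yes _) v = trans (+-identityˡ (1ℤ * v)) (*-identityˡ v)
    ⟦¬?⟧*+⟦⟧* (no _)  v = trans (+-identityʳ (1ℤ * v)) (*-identityˡ v)

    ⟦¬?⟧*-zero : (d : Dec A) {v : ℤ} → (¬ A → v ≡ 0ℤ) → ⟦ ¬? d ⟧ * v ≡ 0ℤ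
    ⟦¬?⟧*-zero (yes _)  _   = refl
    ⟦¬?⟧*-zero (no ¬a) v≡0 = trans (*-identityˡ _) (v≡0 ¬a)

  ⟦⟧-cong : ∀ {a b} {A : Set a} {B : Set b} (a? : Dec A) (b? : Dec B) → A ⇔ B → ⟦ a? ⟧ ≡ ⟦ b? ⟧
  ⟦⟧-cong (yes a)  b? A⇔B = sym (⟦⟧-yes b? (Equivalence.to A⇔B a))
  ⟦⟧-cong (no ¬a) b? A⇔B = sym (⟦⟧-no b? (¬a ∘ Equivalence.from A⇔B))

  ∑-zero : ∀ {n} (f : Fin n → ℤ) → (∀ i → f i ≡ 0ℤ) → ∑[ i < n ] f i ≡ 0ℤ
  ∑-zero {n} f f≡0 = trans (sum-cong-≗ f≡0) (sum-replicate-zero n)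

  ∑-const : ∀ n c → ∑[ i < n ] c ≡ + n * c
  ∑-const zero    c = sym (*-zeroˡ c)
  ∑-const (suc n) c = trans (cong (_+_ c) (∑-const n c)) (step c (+ n))
    where
    step : ∀ c k → c + k * c ≡ (1ℤ + k) * c
    step = solve-∀

  ∑-single : ∀ {n} (f : Fin n → ℤ) (i : Fin n) → (∀ j → j ≢ i → f j ≡ 0ℤ) → ∑[ j < n ] f j ≡ f i
  ∑-single {suc n} f i f≡0 = begin
    sum f                            ≡⟨ sum-remove f ⟩
    f i + ∑[ j < n ] f (punchIn i j) ≡⟨ cong (_+_ (f i)) (∑-zero _ (λ j → f≡0 _ (punchInᵢ≢i i j))) ⟩
    f i + 0ℤ                         ≡⟨ +-identityʳ (f i) ⟩
    f i                              ∎
    where open ≡-Reasoning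

  ∑-⟦⟧-unique : ∀ {n p} {P : Fin n → Set p} (P? : ∀ i → Dec (P i)) → (∀ {i j} → P i → P j → i ≡ j) →
    ∀ v → ∑[ i < n ] (⟦ P? i ⟧ * v) ≡ ⟦ any? P? ⟧ * v
  ∑-⟦⟧-unique P? unique v with any? P?
  ... | yes (i , Pi) = begin
    ∑[ j < _ ] (⟦ P? j ⟧ * v) ≡⟨ ∑-single _ i (λ j j≢i → ⟦⟧*-no (P? j) (λ Pj → j≢i (unique Pj Pi)) v) ⟩
    ⟦ P? i ⟧ * v              ≡⟨ ⟦⟧*-yes (P? i) Pi v ⟩
    v                         ≡⟨ *-identityˡ v ⟨
    1ℤ * v                    ∎
    where open ≡-Reasoning
  ... | no ¬∃ = ∑-zero _ (λ i → ⟦⟧*-no (P? i) (λ Pi → ¬∃ (i , Pi)) v)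

  ∑-∣ : ∀ {m n} (f : Fin n → ℤ) → (∀ i → m ∣ f i) → m ∣ ∑[ i < n ] f i
  ∑-∣ {n = zero}  f m∣f = ∣n⇒∣m*n 0ℤ ∣-refl
  ∑-∣ {n = suc n} f m∣f = ∣m∣n⇒∣m+n (m∣f zero) (∑-∣ (f ∘ suc) (m∣f ∘ suc))

  ∑-rotate : ∀ K (g : ℕ → ℤ) → g K ≡ g 0 → ∑[ j < K ] g (suc (toℕ j)) ≡ ∑[ j < K ] g (toℕ j)
  ∑-rotate K g gK≡g0 = begin
    A                              ≡⟨ cancelˡ (g 0) A ⟨
    (g 0 + A) - g 0                ≡⟨ cong (_- g 0) (sum-init-last {K} (g ∘ toℕ)) ⟩
    (B′ + g (toℕ (fromℕ K))) - g 0 ≡⟨ cong₂ (λ u v → (u + v) - g 0) (sum-cong-≗ {K} (cong g ∘ toℕ-inject₁))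
                                                                     (trans (cong g (toℕ-fromℕ K)) gK≡g0) ⟩
    (B + g 0) - g 0                ≡⟨ cancelʳ B (g 0) ⟩
    B                              ∎
    where
    open ≡-Reasoning
    A = ∑[ j < K ] g (suc (toℕ j))
    B = ∑[ j < K ] g (toℕ j)
    B′ = ∑[ j < K ] g (toℕ (inject₁ j))
    cancelˡ : ∀ a b → (a + b) - a ≡ b
    cancelˡ = solve-∀
    cancelʳ : ∀ a b → (a + b) - b ≡ a
    cancelʳ = solve-∀

  count≡∑⟦⟧ : ∀ {a p} {A : Set a} {P : A → Set p} (P? : ∀ x → Dec (P x)) {k} (g : Fin k → A) →
    + count P? (tabulate g) ≡ ∑[ i < k ] ⟦ P? (g i) ⟧
  count≡∑⟦⟧ P? {zero}  g = refl
  count≡∑⟦⟧ P? {suc k} g with P? (g zero)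
  ... | yes _ = cong (_+_ 1ℤ) (count≡∑⟦⟧ P? (g ∘ suc))
  ... | no _  = trans (count≡∑⟦⟧ P? (g ∘ suc)) (sym (+-identityˡ _))

  module _ {k l} {R : Fin k → Fin l → Set} (R? : ∀ s t → Dec (R s t))
           (functional : ∀ {s t t′} → R s t → R s t′ → t ≡ t′)
           (injective : ∀ {s s′ t} → R s t → R s′ t → s ≡ s′) where

    ∑-cancel-matched : (x : Fin k → ℤ) (y : Fin l → ℤ) → (∀ {s t} → R s t → x s ≡ y t) →
      ∑[ s < k ] x s - ∑[ t < l ] y t
        ≡ ∑[ s < k ] (⟦ ¬? (any? (R? s)) ⟧ * x s) - ∑[ t < l ] (⟦ ¬? (any? (λ s → R? s t)) ⟧ * y t)
    ∑-cancel-matched x y x≡y = begin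
      ∑[ s < k ] x s - ∑[ t < l ] y t
        ≡⟨ cong₂ _-_ (sum-cong-≗ row) (sum-cong-≗ column) ⟩
      ∑[ s < k ] (xᵤ s + ∑[ t < l ] χ s t) - ∑[ t < l ] (yᵤ t + ∑[ s < k ] χ s t)
        ≡⟨ cong₂ _-_ (∑-distrib-+ xᵤ _) (∑-distrib-+ yᵤ _) ⟩
      (∑[ s < k ] xᵤ s + ∑[ s < k ] ∑[ t < l ] χ s t) - (∑[ t < l ] yᵤ t + D)
        ≡⟨ cong (λ z → (∑[ s < k ] xᵤ s + z) - (∑[ t < l ] yᵤ t + D)) (∑-comm χ) ⟩
      (∑[ s < k ] xᵤ s + D) - (∑[ t < l ] yᵤ t + D)
        ≡⟨ cancel (∑[ s < k ] xᵤ s) (∑[ t < l ] yᵤ t) D ⟩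
      ∑[ s < k ] xᵤ s - ∑[ t < l ] yᵤ t
        ∎
      where
      open ≡-Reasoning
      χ : Fin k → Fin l → ℤ
      χ s t = ⟦ R? s t ⟧ * x s
      xᵤ : Fin k → ℤ
      xᵤ s = ⟦ ¬? (any? (R? s)) ⟧ * x s
      yᵤ : Fin l → ℤ
      yᵤ t = ⟦ ¬? (any? (λ s → R? s t)) ⟧ * y t
      D : ℤ
      D = ∑[ t < l ] ∑[ s < k ] χ s t
      cancel : ∀ a b d → (a + d) - (b + d) ≡ a - b
      cancel = solve-∀
      row : ∀ s → x s ≡ xᵤ s + ∑[ t < l ] χ s t
      row s = sym (trans (cong (_+_ (xᵤ s)) (∑-⟦⟧-unique (R? s) functional (x s)))
                         (⟦¬?⟧*+⟦⟧* (any? (R? s)) (x s)))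
      column : ∀ t → y t ≡ yᵤ t + ∑[ s < k ] χ s t
      column t = sym (begin
        yᵤ t + ∑[ s < k ] χ s t
          ≡⟨ cong (_+_ (yᵤ t)) (sum-cong-≗ λ s → ⟦⟧*-cong (R? s t) x≡y) ⟩
        yᵤ t + ∑[ s < k ] (⟦ R? s t ⟧ * y t)
          ≡⟨ cong (_+_ (yᵤ t)) (∑-⟦⟧-unique (λ s → R? s t) injective (y t)) ⟩
        yᵤ t + ⟦ any? (λ s → R? s t) ⟧ * y t
          ≡⟨ ⟦¬?⟧*+⟦⟧* (any? (λ s → R? s t)) (y t) ⟩
        y t
          ∎)

module Differences where

  open Sums
  open import Data.Nat as ℕ using (ℕ; zero; suc)
  open import Data.Nat.GCD using (gcd; gcd-GCD; module Bézout)
  import Data.Nat.Divisibility as ℕ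
  open import Data.Integer using (ℤ; +_; _+_; _-_; _*_; 0ℤ; -1ℤ)
  open import Data.Integer.Properties using (pos-+; +-assoc; +-identityʳ; +-inverseʳ; *-zeroˡ)
  open import Data.Integer.Divisibility.Signed using (_∣_; ∣m∣n⇒∣m-n)
  open import Data.Integer.Tactic.RingSolver using (solve-∀)
  open import Data.Fin as Fin using (Fin; toℕ)
  open import Data.List using (List; []; _∷_; map)
  open import Data.List.Membership.Propositional using (_∈_; _∉_)
  open import Data.List.Relation.Unary.Any using (here; there)
  open import Data.List.Relation.Unary.All.Properties using (All¬⇒¬Any)
  open import Data.List.Relation.Unary.Unique.Propositional using (Unique; _∷_)
  open import Data.Empty using (⊥-elim)
  open import Function using (id; _∘_)
  open import Relation.Nullary using (yes; no)
  open import Relation.Binary.PropositionalEquality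

  Periodic : (ℤ → ℤ) → ℕ → Set
  Periodic φ h = ∀ y → φ (y + + h) ≡ φ y

  record Linear (T : (ℤ → ℤ) → ℤ → ℤ) : Set where
    field
      ext   : ∀ {φ ψ} → φ ≗ ψ → T φ ≗ T ψ
      +-hom : ∀ φ ψ → T (λ x → φ x + ψ x) ≗ λ y → T φ y + T ψ y
      *-hom : ∀ c φ → T (λ x → c * φ x) ≗ λ y → c * T φ y
      ∣-hom : ∀ {m} φ → (∀ x → m ∣ φ x) → ∀ y → m ∣ T φ y

    0-hom : ∀ y → T (λ _ → 0ℤ) y ≡ 0ℤ
    0-hom y = trans (*-hom 0ℤ (λ _ → 0ℤ) y) (*-zeroˡ (T (λ _ → 0ℤ) y))

    -‿hom : ∀ φ ψ → T (λ x → φ x - ψ x) ≗ λ y → T φ y - T ψ y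
    -‿hom φ ψ y = begin
      T (λ x → φ x - ψ x) y             ≡⟨ ext (λ x → minus (φ x) (ψ x)) y ⟩
      T (λ x → φ x + -1ℤ * ψ x) y       ≡⟨ +-hom φ _ y ⟩
      T φ y + T (λ x → -1ℤ * ψ x) y     ≡⟨ cong (λ z → T φ y + z) (*-hom -1ℤ ψ y) ⟩
      T φ y + -1ℤ * T ψ y               ≡⟨ minus (T φ y) (T ψ y) ⟨
      T φ y - T ψ y                     ∎
      where
      open ≡-Reasoning
      minus : ∀ a b → a - b ≡ a + -1ℤ * b
      minus = solve-∀

    ∑-hom : ∀ {k} (F : Fin k → ℤ → ℤ) → T (λ x → ∑[ s < k ] F s x) ≗ λ y → ∑[ s < k ] T (F s) y
    ∑-hom {zero} F y = 0-hom y
    ∑-hom {suc k} F y =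
      trans (+-hom (F Fin.zero) _ y) (cong (λ z → T (F Fin.zero) y + z) (∑-hom (λ s → F (Fin.suc s)) y))

  open Linear

  ∘-linear : ∀ {S T} → Linear S → Linear T → Linear (λ φ → S (T φ))
  ∘-linear {S} {T} LS LT = record
    { ext   = λ φ≗ψ → ext LS (ext LT φ≗ψ)
    ; +-hom = λ φ ψ y → trans (ext LS (+-hom LT φ ψ) y) (+-hom LS (T φ) (T ψ) y)
    ; *-hom = λ c φ y → trans (ext LS (*-hom LT c φ) y) (*-hom LS c (T φ) y)
    ; ∣-hom = λ φ m∣φ → ∣-hom LS (T φ) (∣-hom LT φ m∣φ)
    }

  Δ : ℕ → (ℤ → ℤ) → ℤ → ℤ
  Δ h φ y = φ y - φ (y + + h)

  Δ* : List ℕ → (ℤ → ℤ) → ℤ → ℤ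
  Δ* []       φ = φ
  Δ* (h ∷ hs) φ = Δ h (Δ* hs φ)

  Δ-linear : ∀ h → Linear (Δ h)
  Δ-linear h = record
    { ext   = λ φ≗ψ y → cong₂ _-_ (φ≗ψ y) (φ≗ψ (y + + h))
    ; +-hom = λ φ ψ y → interchange (φ y) (ψ y) (φ (y + + h)) (ψ (y + + h))
    ; *-hom = λ c φ y → distrib c (φ y) (φ (y + + h))
    ; ∣-hom = λ φ m∣φ y → ∣m∣n⇒∣m-n (m∣φ y) (m∣φ (y + + h))
    }
    where
    interchange : ∀ a b c d → (a + b) - (c + d) ≡ (a - c) + (b - d)
    interchange = solve-∀
    distrib : ∀ c a b → c * a - c * b ≡ c * (a - b)
    distrib = solve-∀

  Δ*-linear : ∀ hs → Linear (Δ* hs)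
  Δ*-linear []       = record { ext = id ; +-hom = λ _ _ _ → refl ; *-hom = λ _ _ _ → refl ; ∣-hom = λ _ → id }
  Δ*-linear (h ∷ hs) = ∘-linear (Δ-linear h) (Δ*-linear hs)

  average : ℕ → ℕ → (ℤ → ℤ) → ℤ → ℤ
  average K n φ y = ∑[ j < K ] φ (y + + (toℕ j ℕ.* n))

  average-linear : ∀ K n → Linear (average K n)
  average-linear K n = record
    { ext   = λ φ≗ψ y → sum-cong-≗ {K} (λ j → φ≗ψ _)
    ; +-hom = λ φ ψ y → ∑-distrib-+ {K} _ _
    ; *-hom = λ c φ y → sym (*-distribˡ-sum {K} c _)
    ; ∣-hom = λ φ m∣φ y → ∑-∣ {n = K} _ (λ j → m∣φ _)
    }

  private
    shift-+ : ∀ y a b → y + + (a ℕ.+ b) ≡ (y + + a) + + b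
    shift-+ y a b = trans (cong (_+_ y) (pos-+ a b)) (sym (+-assoc y (+ a) (+ b)))

    shift-comm : ∀ x u v → (x + u) + v ≡ (x + v) + u
    shift-comm = solve-∀

  periodic-* : ∀ {φ h} → Periodic φ h → ∀ t → Periodic φ (t ℕ.* h)
  periodic-* {φ} φh zero    y = cong φ (+-identityʳ y)
  periodic-* {φ} {h} φh (suc t) y = begin
    φ (y + + (h ℕ.+ t ℕ.* h))   ≡⟨ cong φ (shift-+ y h (t ℕ.* h)) ⟩
    φ ((y + + h) + + (t ℕ.* h)) ≡⟨ periodic-* φh t (y + + h) ⟩
    φ (y + + h)                 ≡⟨ φh y ⟩
    φ y                         ∎
    where open ≡-Reasoning

  periodic-∣ : ∀ {φ g h} → Periodic φ g → g ℕ.∣ h → Periodic φ h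
  periodic-∣ φg (ℕ.divides t refl) = periodic-* φg t

  periodic-∸ : ∀ {φ d h} → Periodic φ h → Periodic φ (d ℕ.+ h) → Periodic φ d
  periodic-∸ {φ} {d} {h} φh φd+h y = begin
    φ (y + + d)                 ≡⟨ φh (y + + d) ⟨
    φ ((y + + d) + + h)         ≡⟨ cong φ (shift-+ y d h) ⟨
    φ (y + + (d ℕ.+ h))         ≡⟨ φd+h y ⟩
    φ y                         ∎
    where open ≡-Reasoning

  periodic-gcd : ∀ {φ m n} → Periodic φ m → Periodic φ n → Periodic φ (gcd m n)
  periodic-gcd {φ} {m} {n} φm φn with Bézout.identity (gcd-GCD m n)
  ... | Bézout.+- x y eq = periodic-∸ (periodic-* φn y) (subst (Periodic φ) (sym eq) (periodic-* φm x))
  ... | Bézout.-+ x y eq = periodic-∸ (periodic-* φm x) (subst (Periodic φ) (sym eq) (periodic-* φn y))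

  Δ*-periodic : ∀ {φ h} → Periodic φ h → ∀ hs → Periodic (Δ* hs φ) h
  Δ*-periodic φh []        y = φh y
  Δ*-periodic {φ} {h} φh (h′ ∷ hs) y =
    cong₂ _-_ (ψh y) (trans (cong ψ (shift-comm y (+ h) (+ h′))) (ψh (y + + h′)))
    where
    ψ = Δ* hs φ
    ψh = Δ*-periodic φh hs

  Δ*-annihilates : ∀ {φ h hs} → h ∈ hs → Periodic φ h → ∀ y → Δ* hs φ y ≡ 0ℤ
  Δ*-annihilates {φ} {hs = h ∷ hs} (here refl) φh y =
    trans (cong (_-_ (Δ* hs φ y)) (Δ*-periodic φh hs y)) (+-inverseʳ (Δ* hs φ y))
  Δ*-annihilates {φ} {hs = h′ ∷ hs} (there h∈hs) φh y =
    cong₂ _-_ (Δ*-annihilates h∈hs φh y) (Δ*-annihilates h∈hs φh (y + + h′))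

  -- Δ* (map sh P) φ y is a signed sum of values of φ at y + ∑ (sh q) over subsets of P,
  -- and all these points lie in Z.
  Δ*-vanish : ∀ (sh : ℕ → ℕ) {p} (Z : ℤ → Set) {φ} → (∀ {x} → Z x → φ x ≡ 0ℤ) →
    ∀ P → Unique P → (∀ {p′} → p′ ∈ P → p′ ≢ p → ∀ {x} → Z x → Z (x + + sh p′)) →
    ∀ {y} → Z y → (p ∈ P → Z (y + + sh p)) → Δ* (map sh P) φ y ≡ 0ℤ
  Δ*-vanish sh Z φ∣Z []       _           _      Zy _ = φ∣Z Zy
  Δ*-vanish sh {p} Z {φ} φ∣Z (p′ ∷ P) (p′∉P ∷ uP) closed {y} Zy Zy+p with p′ ℕ.≟ p
  ... | yes refl = cong₂ _-_ (vanish Zy (⊥-elim ∘ p∉P)) (vanish (Zy+p (here refl)) (⊥-elim ∘ p∉P))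
    where
    vanish : ∀ {x} → Z x → (p ∈ P → Z (x + + sh p)) → Δ* (map sh P) φ x ≡ 0ℤ
    vanish = Δ*-vanish sh Z φ∣Z P uP (λ p″∈P → closed (there p″∈P))
    p∉P : p ∉ P
    p∉P = All¬⇒¬Any p′∉P
  ... | no p′≢p = cong₂ _-_
    (vanish Zy (Zy+p ∘ there))
    (vanish (shift Zy) (λ p∈P → subst Z (shift-comm y (+ sh p) (+ sh p′)) (shift (Zy+p (there p∈P)))))
    where
    vanish : ∀ {x} → Z x → (p ∈ P → Z (x + + sh p)) → Δ* (map sh P) φ x ≡ 0ℤ
    vanish = Δ*-vanish sh Z φ∣Z P uP (λ p″∈P → closed (there p″∈P))
    shift : ∀ {x} → Z x → Z (x + + sh p′)
    shift = closed (here refl) p′≢p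

  average-periodic : ∀ {φ d} K n → Periodic φ d → Periodic (average K n φ) d
  average-periodic {φ} {d} K n φd y = sum-cong-≗ {K} λ j →
    trans (cong φ (shift-comm y (+ d) (+ (toℕ j ℕ.* n)))) (φd (y + + (toℕ j ℕ.* n)))

  average-periodic-step : ∀ {φ} K n → Periodic φ (K ℕ.* n) → Periodic (average K n φ) n
  average-periodic-step {φ} K n φKn y = begin
    average K n φ (y + + n)                  ≡⟨ sum-cong-≗ {K} (λ j → cong φ (shift-+ y n (toℕ j ℕ.* n))) ⟨
    ∑[ j < K ] g (suc (toℕ j))               ≡⟨ ∑-rotate K g (trans (φKn y) (cong φ (sym (+-identityʳ y)))) ⟩
    average K n φ y                          ∎
    where
    open ≡-Reasoning
    g : ℕ → ℤ
    g j = φ (y + + (j ℕ.* n))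

  average-of-periodic : ∀ {φ} K n → Periodic φ n → ∀ y → average K n φ y ≡ + K * φ y
  average-of-periodic {φ} K n φn y =
    trans (sum-cong-≗ {K} (λ j → periodic-* φn (toℕ j) y)) (∑-const K (φ y))

module PrimeParts where

  open import Data.Nat
  open import Data.Nat.Properties
  open import Data.Nat.Divisibility
  open import Data.Nat.DivMod using (_/_; m*[n/m]≡n)
  open import Data.Nat.Induction using (<-rec)
  open import Data.Nat.Tactic.RingSolver using (solve-∀)
  open import Data.Nat.Primality
  open import Data.Nat.Primality.Factorisation using (factorise)
  open import Data.Nat.ListAction using (product)
  open import Data.List using (List; []; _∷_; filter; upTo)
  open import Data.List.Membership.Propositional using (_∈_)
  open import Data.List.Membership.Propositional.Properties using (∈-filter⁺; ∈-upTo⁺)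
  open import Data.List.Relation.Unary.All using (All; _∷_)
  open import Data.List.Relation.Unary.All.Properties using (all-filter)
  open import Data.List.Relation.Unary.Unique.Propositional using (Unique)
  open import Data.List.Relation.Unary.Unique.Propositional.Properties using (filter⁺; upTo⁺)
  open import Data.Product using (∃; Σ; _×_; _,_)
  open import Data.Nat.GCD using (gcd[m,n]∣m; gcd[m,n]∣n; gcd-greatest)
  open import Data.Sum using (inj₁; inj₂)
  open import Relation.Nullary using (Dec; ¬_; yes; no; contradiction)
  open import Relation.Nullary.Decidable using (_×-dec_)
  open import Relation.Binary.PropositionalEquality
  open import Function using (_∘_)

  PrimeFactor : ℕ → ℕ → Set
  PrimeFactor n p = Prime p × p ∣ n

  primeFactor? : ∀ n p → Dec (PrimeFactor n p)
  primeFactor? n p = prime? p ×-dec p ∣? n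

  primeFactors : ℕ → List ℕ
  primeFactors n = filter (primeFactor? n) (upTo (suc n))

  primeFactors-sound : ∀ n → All (PrimeFactor n) (primeFactors n)
  primeFactors-sound n = all-filter (primeFactor? n) (upTo (suc n))

  primeFactors-unique : ∀ n → Unique (primeFactors n)
  primeFactors-unique n = filter⁺ (primeFactor? n) (upTo⁺ (suc n))

  ∈-primeFactors : ∀ {n p} .{{_ : NonZero n}} → PrimeFactor n p → p ∈ primeFactors n
  ∈-primeFactors {n} pf@(_ , p∣n) = ∈-filter⁺ (primeFactor? n) (∈-upTo⁺ (s≤s (∣⇒≤ p∣n))) pf

  cofactor : ℕ → ℕ → ℕ
  cofactor n zero      = 0
  cofactor n p@(suc _) = n / p

  *-cofactor : ∀ {n p} → Prime p → p ∣ n → p * cofactor n p ≡ n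
  *-cofactor {p = suc _} _ p∣n = m*[n/m]≡n p∣n

  ∃-prime∣ : ∀ {r} → 1 < r → ∃ λ p → Prime p × p ∣ r
  ∃-prime∣ {r} 1<r with factorise r {{>-nonZero (<-trans z<s 1<r)}}
  ... | record { factors = [] ; isFactorisation = r≡1 } = contradiction r≡1 (>⇒≢ 1<r)
  ... | record { factors = p ∷ ps ; isFactorisation = r≡Πps ; factorsPrime = prime[p] ∷ _ } =
    p , prime[p] , subst (p ∣_) (sym r≡Πps) (m∣m*n (product ps))

  proper-divisor⇒∣cofactor : ∀ {n g} .{{_ : NonZero n}} → g ∣ n → g ≢ n →
    ∃ λ p → PrimeFactor n p × g ∣ cofactor n p
  proper-divisor⇒∣cofactor {n} (divides 0 n≡0) _ = contradiction n≡0 (≢-nonZero⁻¹ n)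
  proper-divisor⇒∣cofactor {n} {g} (divides 1 n≡1*g) g≢n = contradiction (sym (trans n≡1*g (*-identityˡ g))) g≢n
  proper-divisor⇒∣cofactor {n} {g} (divides r@(suc (suc _)) n≡rg) _ with ∃-prime∣ {r} (s<s z<s)
  ... | p , prime[p] , p∣r = p , (prime[p] , p∣n) , *-cancelˡ-∣ p {{prime⇒nonZero prime[p]}} pg∣p[n/p]
    where
    p∣n : p ∣ n
    p∣n = ∣-trans p∣r (divides g (trans n≡rg (*-comm r g)))
    pg∣p[n/p] : p * g ∣ p * cofactor n p
    pg∣p[n/p] = subst (p * g ∣_) (trans (sym n≡rg) (sym (*-cofactor prime[p] p∣n))) (*-pres-∣ p∣r (∣-refl {g}))

  record ExactPower (p n : ℕ) : Set where
    field
      exponent : ℕ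
      pow∣     : p ^ exponent ∣ n
      pow-max  : ¬ p ^ suc exponent ∣ n

  exactPower : ∀ {p} → 1 < p → ∀ n → .{{NonZero n}} → ExactPower p n
  exactPower {p} 1<p n {{n≢0}} = <-rec (λ n → .(NonZero n) → ExactPower p n) step n n≢0
    where
    step : ∀ n → (∀ {m} → m < n → .(NonZero m) → ExactPower p m) → .(NonZero n) → ExactPower p n
    step n rec n≢0 with p ∣? n
    ... | no p∤n = record
      { exponent = 0 ; pow∣ = 1∣ n ; pow-max = λ p¹∣n → p∤n (subst (_∣ n) (*-identityʳ p) p¹∣n) }
    ... | yes (divides m n≡mp) = record
      { exponent = suc e
      ; pow∣     = subst (p ^ suc e ∣_) (sym n≡pm) (*-monoʳ-∣ p pow∣)
      ; pow-max  = λ p^2+e∣n → pow-max (*-cancelˡ-∣ p {{p≢0}} (subst (p ^ suc (suc e) ∣_) n≡pm p^2+e∣n))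
      }
      where
      p≢0 : NonZero p
      p≢0 = >-nonZero (<-trans z<s 1<p)
      n≡pm : n ≡ p * m
      n≡pm = trans n≡mp (*-comm m p)
      m≢0 : NonZero m
      m≢0 = ≢-nonZero λ { refl → ≢-nonZero⁻¹ n {{n≢0}} (trans n≡mp (*-zeroˡ p)) }
      open ExactPower (rec (subst (m <_) (sym n≡mp) (m<m*n m p {{m≢0}} 1<p)) m≢0)
      e = exponent

  prime∣prime⇒≡ : ∀ {p p′} → Prime p → Prime p′ → p ∣ p′ → p ≡ p′
  prime∣prime⇒≡ prime[p] prime[p′] p∣p′ with prime⇒irreducible prime[p′] p∣p′
  ... | inj₁ refl = contradiction prime[p] ¬prime[1]
  ... | inj₂ p≡p′ = p≡p′

  prime^∣*⇒∣ : ∀ {p p′} → Prime p → Prime p′ → p ≢ p′ → ∀ e x → p ^ e ∣ p′ * x → p ^ e ∣ x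
  prime^∣*⇒∣ _ _ _ zero x _ = 1∣ x
  prime^∣*⇒∣ {p} {p′} prime[p] prime[p′] p≢p′ (suc e) x p^e+1∣p′x
    with euclidsLemma p′ x prime[p] (∣-trans (m∣m*n (p ^ e)) p^e+1∣p′x)
  ... | inj₁ p∣p′ = contradiction (prime∣prime⇒≡ prime[p] prime[p′] p∣p′) p≢p′
  ... | inj₂ (divides y refl) = subst (p ^ suc e ∣_) (*-comm p y) (*-monoʳ-∣ p p^e∣y)
    where
    instance _ = prime⇒nonZero prime[p]
    rotate : ∀ a b c → a * (b * c) ≡ c * (a * b)
    rotate = solve-∀
    p^e∣y : p ^ e ∣ y
    p^e∣y = prime^∣*⇒∣ prime[p] prime[p′] p≢p′ e y
      (*-cancelˡ-∣ p (subst (p ^ suc e ∣_) (rotate p′ y p) p^e+1∣p′x))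

  prime^∣2*⇒≡2 : ∀ {p} → Prime p → ∀ e x → p ^ e ∣ 2 * x → ¬ p ^ e ∣ x → p ≡ 2
  prime^∣2*⇒≡2 {p} prime[p] e x p^e∣2x p^e∤x with p ≟ 2
  ... | yes p≡2 = p≡2
  ... | no p≢2 = contradiction (prime^∣*⇒∣ prime[p] prime[2] p≢2 e x p^e∣2x) p^e∤x

  module _ {n} .{{_ : NonZero n}} where

    exactPowerOf : ∀ {p} → PrimeFactor n p → ExactPower p n
    exactPowerOf {p} (prime[p] , _) = exactPower (nonTrivial⇒n>1 p {{prime⇒nonTrivial prime[p]}}) n

    part : ∀ {p} → PrimeFactor n p → ℕ
    part {p} pf = p ^ ExactPower.exponent (exactPowerOf pf)

    part∣ : ∀ {p} (pf : PrimeFactor n p) → part pf ∣ n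
    part∣ pf = ExactPower.pow∣ (exactPowerOf pf)

    part∤cofactor : ∀ {p} (pf : PrimeFactor n p) → ¬ part pf ∣ cofactor n p
    part∤cofactor {p} pf@(prime[p] , p∣n) q∣n/p =
      ExactPower.pow-max (exactPowerOf pf) (subst (p * part pf ∣_) (*-cofactor prime[p] p∣n) (*-monoʳ-∣ p q∣n/p))

    part∣cofactor : ∀ {p p′} (pf : PrimeFactor n p) → PrimeFactor n p′ → p ≢ p′ → part pf ∣ cofactor n p′
    part∣cofactor {p} {p′} pf@(prime[p] , _) (prime[p′] , p′∣n) p≢p′ =
      prime^∣*⇒∣ prime[p] prime[p′] p≢p′ (ExactPower.exponent (exactPowerOf pf)) (cofactor n p′)
        (subst (part pf ∣_) (sym (*-cofactor prime[p′] p′∣n)) (part∣ pf))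

    part∣2*⇒≡2 : ∀ {p} (pf : PrimeFactor n p) x → part pf ∣ 2 * x → ¬ part pf ∣ x → p ≡ 2
    part∣2*⇒≡2 pf@(prime[p] , _) = prime^∣2*⇒≡2 prime[p] (ExactPower.exponent (exactPowerOf pf))

    ∃-part∤ : ∀ {z} → ¬ n ∣ z → ∃ λ p → Σ (PrimeFactor n p) λ pf → ¬ part pf ∣ z
    ∃-part∤ {z} n∤z
      with proper-divisor⇒∣cofactor (gcd[m,n]∣m n z) (n∤z ∘ λ g≡n → subst (_∣ z) g≡n (gcd[m,n]∣n n z))
    ... | p , pf , g∣n/p = p , pf , λ q∣z → part∤cofactor pf (∣-trans (gcd-greatest (part∣ pf) q∣z) g∣n/p)

module ResidueClasses where

  open import Defs
  open Sums
  open Differences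
  open import Data.Nat as ℕ using (ℕ)
  import Data.Nat.Divisibility as ℕ
  open import Data.Integer using (ℤ; +_; _+_; _-_; 0ℤ; 1ℤ)
  open import Data.Integer.Divisibility.Signed using (_∣_; ∣ᵤ⇒∣; ∣⇒∣ᵤ; ∣m∣n⇒∣m+n; ∣m∣n⇒∣m-n)
  open import Data.Integer.Tactic.RingSolver using (solve-∀)
  open import Data.Fin using (Fin)
  open import Function using (id)
  open import Function.Bundles using (_⇔_; mk⇔)
  open import Relation.Nullary using (¬_)
  open import Relation.Binary.PropositionalEquality

  ∈RC-resp : ∀ {x x′ c c′ d} → + d ∣ (x - c) - (x′ - c′) → x ∈RC c ⟨ d ⟩ ⇔ x′ ∈RC c′ ⟨ d ⟩
  ∈RC-resp {x} {x′} {c} {c′} {d} d∣δ = mk⇔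
    (λ x∈ → ∣⇒∣ᵤ (subst (_ ∣_) (sub-δ (x - c) (x′ - c′)) (∣m∣n⇒∣m-n (∣ᵤ⇒∣ {+ d} {x - c} x∈) d∣δ)))
    (λ x′∈ → ∣⇒∣ᵤ (subst (_ ∣_) (add-δ (x - c) (x′ - c′)) (∣m∣n⇒∣m+n (∣ᵤ⇒∣ {+ d} {x′ - c′} x′∈) d∣δ)))
    where
    sub-δ : ∀ u v → u - (u - v) ≡ v
    sub-δ = solve-∀
    add-δ : ∀ u v → v + (u - v) ≡ u
    add-δ = solve-∀

  indicator : ℤ → ℕ → ℤ → ℤ
  indicator c d x = ⟦ x ∈RC? c ⟨ d ⟩ ⟧

  indicator-1 : ∀ {c d x} → + d ∣ x - c → indicator c d x ≡ 1ℤ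
  indicator-1 {c} {d} {x} d∣x-c = ⟦⟧-yes (x ∈RC? c ⟨ d ⟩) (∣⇒∣ᵤ d∣x-c)

  indicator-0 : ∀ {c d x} → ¬ + d ∣ x - c → indicator c d x ≡ 0ℤ
  indicator-0 {c} {d} {x} d∤x-c = ⟦⟧-no (x ∈RC? c ⟨ d ⟩) (λ d∣ → d∤x-c (∣ᵤ⇒∣ d∣))

  indicator-periodic : ∀ {c d h} → d ℕ.∣ h → Periodic (indicator c d) h
  indicator-periodic {c} {d} {h} d∣h y =
    ⟦⟧-cong ((y + + h) ∈RC? c ⟨ d ⟩) (y ∈RC? c ⟨ d ⟩)
      (∈RC-resp {y + + h} {y} {c} {c} (subst (+ d ∣_) (shift y c (+ h)) (∣ᵤ⇒∣ {+ d} {+ h} d∣h)))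
    where
    shift : ∀ y c h → h ≡ ((y + h) - c) - (y - c)
    shift = solve-∀

  cover≡∑indicator : ∀ {k} (a : Fin k → ℤ) (n : Fin k → ℕ) x →
    + cover a n x ≡ ∑[ s < k ] indicator (a s) (n s) x
  cover≡∑indicator a n x = count≡∑⟦⟧ (λ s → x ∈RC? a s ⟨ n s ⟩) id

module Detectors where

  open import Data.Nat as ℕ using (ℕ; NonZero; _≟_)
  open Differences
  open ResidueClasses
  open PrimeParts
  import Data.Nat.Properties as ℕ
  import Data.Nat.Divisibility as ℕ
  open import Data.Integer using (ℤ; +_; _+_; _-_; -_; 0ℤ; 1ℤ; -1ℤ)
  open import Data.Integer.Properties using (pos-+; +-inverseʳ)
  open import Data.Integer.Divisibility.Signed
    using (_∣_; _∣?_; ∣-refl; ∣ᵤ⇒∣; ∣⇒∣ᵤ; ∣-trans; ∣m∣n⇒∣m+n; ∣m∣n⇒∣m-n; ∣m+n∣n⇒∣m; ∣m+n∣m⇒∣n; ∣m⇒∣-m)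
  open import Data.Integer.Tactic.RingSolver using (solve-∀)
  open import Data.List using (List; []; _∷_; map)
  open import Data.List.Membership.Propositional using (_∈_)
  open import Data.List.Relation.Unary.Any using (here; there)
  open import Data.List.Relation.Unary.All as All using (All; _∷_)
  open import Data.List.Relation.Unary.All.Properties using (All¬⇒¬Any)
  open import Data.List.Relation.Unary.Unique.Propositional using (Unique; _∷_)
  open import Data.Product using (∃₂; _×_; _,_; proj₂)
  open import Data.Sum using (_⊎_; inj₁; inj₂)
  open import Data.Empty using (⊥-elim)
  open import Function using (_∘_)
  open import Relation.Nullary using (¬_; yes; no; contradiction)
  open import Relation.Binary.PropositionalEquality

  module Detector (n : ℕ) .{{_ : NonZero n}} where

    sh : ℕ → ℕ
    sh = cofactor n

    detectorOn : List ℕ → ℤ → ℤ → ℤ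
    detectorOn Q c = Δ* (map sh Q) (indicator c n)

    shifts : List ℕ
    shifts = map sh (primeFactors n)

    detector : ℤ → ℤ → ℤ
    detector = detectorOn (primeFactors n)

    private
      shift-sub : ∀ x h c → (x + h) - c ≡ (x - c) + h
      shift-sub = solve-∀

      sub-add : ∀ z h → (z - h) + h ≡ z
      sub-add = solve-∀

      ∣+∤ : ∀ {q a b} → q ∣ a → ¬ q ∣ b → ¬ q ∣ a + b
      ∣+∤ q∣a q∤b q∣a+b = q∤b (∣m+n∣m⇒∣n q∣a+b q∣a)

      ∤+∣ : ∀ {q a b} → ¬ q ∣ a → q ∣ b → ¬ q ∣ a + b
      ∤+∣ q∤a q∣b q∣a+b = q∤a (∣m+n∣n⇒∣m q∣a+b q∣b)

      part∣n : ∀ {p} (pf : PrimeFactor n p) {z} → + n ∣ z → + part pf ∣ z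
      part∣n pf = ∣-trans (∣ᵤ⇒∣ (part∣ pf))

      part∤sh : ∀ {p} (pf : PrimeFactor n p) → ¬ + part pf ∣ + sh p
      part∤sh pf = part∤cofactor pf ∘ ∣⇒∣ᵤ

      part∣sh : ∀ {p p′} (pf : PrimeFactor n p) → PrimeFactor n p′ → p ≢ p′ → + part pf ∣ + sh p′
      part∣sh pf pf′ p≢p′ = ∣ᵤ⇒∣ (part∣cofactor pf pf′ p≢p′)

      ∤-shifted : ∀ {p} y c (pf : PrimeFactor n p) → + part pf ∣ y - c → ¬ + part pf ∣ (y + + sh p) - c
      ∤-shifted {p} y c pf q∣y-c =
        subst (λ z → ¬ + part pf ∣ z) (sym (shift-sub y (+ sh p) c)) (∣+∤ q∣y-c (part∤sh pf))

      double : ∀ h → + h + + h ≡ + (2 ℕ.* h)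
      double h = trans (sym (pos-+ h h)) (cong (λ k → + (h ℕ.+ k)) (sym (ℕ.+-identityʳ h)))

      sh2+sh2≡n : PrimeFactor n 2 → + sh 2 + + sh 2 ≡ + n
      sh2+sh2≡n (prime[2] , 2∣n) = trans (double (sh 2)) (cong +_ (*-cofactor prime[2] 2∣n))

    detectorOn-vanish : ∀ {Q p y c} → Unique Q → All (PrimeFactor n) Q → (pf : PrimeFactor n p) →
      ¬ + part pf ∣ y - c → (p ∈ Q → ¬ + part pf ∣ (y + + sh p) - c) → detectorOn Q c y ≡ 0ℤ
    detectorOn-vanish {Q} {p} {y} {c} uQ pfs pf =
      Δ*-vanish sh (λ x → ¬ + part pf ∣ x - c) (λ {x} q∤ → indicator-0 {c} {n} {x} (q∤ ∘ part∣n pf)) Q uQ closed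
      where
      closed : ∀ {p′} → p′ ∈ Q → p′ ≢ p → ∀ {x} → ¬ + part pf ∣ x - c → ¬ + part pf ∣ (x + + sh p′) - c
      closed {p′} p′∈Q p′≢p {x} q∤x-c = subst (λ z → ¬ + part pf ∣ z) (sym (shift-sub x (+ sh p′) c))
        (∤+∣ q∤x-c (part∣sh pf (All.lookup pfs p′∈Q) (p′≢p ∘ sym)))

    detectorOn-1 : ∀ {Q y c} → Unique Q → All (PrimeFactor n) Q → + n ∣ y - c → detectorOn Q c y ≡ 1ℤ
    detectorOn-1 {[]}    {y} {c} _ _ n∣y-c = indicator-1 {c} {n} {y} n∣y-c
    detectorOn-1 {p ∷ Q} {y} {c} (p∉Q ∷ uQ) (pf ∷ pfs) n∣y-c = cong₂ _-_
      (detectorOn-1 uQ pfs n∣y-c)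
      (detectorOn-vanish uQ pfs pf (∤-shifted y c pf (part∣n pf n∣y-c)) (⊥-elim ∘ All¬⇒¬Any p∉Q))

    detectorOn-half : ∀ {Q y c} → Unique Q → All (PrimeFactor n) Q → 2 ∈ Q → + n ∣ (y - c) - + sh 2 →
      detectorOn Q c y ≡ -1ℤ
    detectorOn-half {p ∷ Q} {y} {c} (p∉Q ∷ uQ) (pf ∷ pfs) (here refl) n∣y-c-h = cong₂ _-_
      (detectorOn-vanish uQ pfs pf q∤y-c (⊥-elim ∘ All¬⇒¬Any p∉Q))
      (detectorOn-1 uQ pfs n∣y+h-c)
      where
      q∤y-c : ¬ + part pf ∣ y - c
      q∤y-c = subst (λ z → ¬ + part pf ∣ z) (sub-add (y - c) (+ sh 2)) (∣+∤ (part∣n pf n∣y-c-h) (part∤sh pf))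
      shift-twice : ∀ y h c → (y + h) - c ≡ ((y - c) - h) + (h + h)
      shift-twice = solve-∀
      n∣y+h-c : + n ∣ (y + + sh 2) - c
      n∣y+h-c = subst (+ n ∣_) (sym (shift-twice y (+ sh 2) c))
        (∣m∣n⇒∣m+n n∣y-c-h (subst (+ n ∣_) (sym (sh2+sh2≡n pf)) ∣-refl))
    detectorOn-half {p ∷ Q} {y} {c} (p∉Q ∷ uQ) (pf ∷ pfs) (there 2∈Q) n∣y-c-h = cong₂ _-_
      (detectorOn-half uQ pfs 2∈Q n∣y-c-h)
      (detectorOn-vanish uQ pfs pf (∤-shifted y c pf q∣y-c) (⊥-elim ∘ All¬⇒¬Any p∉Q))
      where
      q∣y-c : + part pf ∣ y - c
      q∣y-c = subst (+ part pf ∣_) (sub-add (y - c) (+ sh 2))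
        (∣m∣n⇒∣m+n (part∣n pf n∣y-c-h) (part∣sh pf (All.lookup pfs 2∈Q) (All.lookup p∉Q 2∈Q)))

    detector-self : ∀ c → detector c c ≡ 1ℤ
    detector-self c = detectorOn-1 (primeFactors-unique n) (primeFactors-sound n)
      (subst (+ n ∣_) (sym (+-inverseʳ c)) (∣ᵤ⇒∣ (n ℕ.∣0)))

    private
      detector-vanish : ∀ {p y c} (pf : PrimeFactor n p) →
        ¬ + part pf ∣ y - c → ¬ + part pf ∣ (y - c) + + sh p → detector c y ≡ 0ℤ
      detector-vanish {p} {y} {c} pf q∤ q∤′ = detectorOn-vanish (primeFactors-unique n) (primeFactors-sound n) pf q∤
        (λ _ → subst (λ z → ¬ + part pf ∣ z) (sym (shift-sub y (+ sh p) c)) q∤′)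

    Separates : ℤ → ℤ → Set
    Separates c c′ = ∃₂ λ y v → detector c y - detector c′ y ≡ v × v ∣ + n

    -- With q the p-part of n: at y = c the detector of c′ vanishes unless q ∣ c - c′ + n/p,
    -- at y = c′ that of c vanishes unless q ∣ c′ - c + n/p, and both together give q ∣ 2n/p.
    separates-at : ∀ {p c c′} (pf : PrimeFactor n p) → ¬ + part pf ∣ c - c′ →
      Separates c c′ ⊎ (p ≡ 2 × + part pf ∣ (c - c′) + + sh p)
    separates-at {p} {c} {c′} pf q∤c-c′ with + part pf ∣? (c - c′) + + sh p
    ... | no q∤ = inj₁ (c , 1ℤ , cong₂ _-_ (detector-self c) (detector-vanish pf q∤c-c′ q∤) , ∣ᵤ⇒∣ (ℕ.1∣ n))
    ... | yes q∣ with + part pf ∣? (c′ - c) + + sh p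
    ...   | no q∤′ = inj₁ (c′ , -1ℤ , cong₂ _-_ (detector-vanish pf q∤c′-c q∤′) (detector-self c′) , ∣ᵤ⇒∣ (ℕ.1∣ n))
      where
      neg-sub : ∀ a b → - (a - b) ≡ b - a
      neg-sub = solve-∀
      q∤c′-c : ¬ + part pf ∣ c′ - c
      q∤c′-c = q∤c-c′ ∘ subst (+ part pf ∣_) (neg-sub c′ c) ∘ ∣m⇒∣-m
    ...   | yes q∣′ = inj₂ (part∣2*⇒≡2 pf (sh p) (∣⇒∣ᵤ q∣2h) (part∤sh pf ∘ ∣ᵤ⇒∣) , q∣)
      where
      both : ∀ a b h → ((a - b) + h) + ((b - a) + h) ≡ h + h
      both = solve-∀
      q∣2h : + part pf ∣ + (2 ℕ.* sh p)
      q∣2h = subst (+ part pf ∣_) (trans (both c c′ (+ sh p)) (double (sh p))) (∣m∣n⇒∣m+n q∣ q∣′)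

    -- Here c - c′ ≡ n/2 modulo the 2-part of n: either c′ ≡ c + n/2 modulo n, and y = c gives
    -- 1 - (-1) = 2, a divisor of n; or some odd prime power of n does not divide c - c′ - n/2,
    -- hence not c - c′ either, and separates-at applies to it.
    separates-half : ∀ {c c′} (pf : PrimeFactor n 2) → + part pf ∣ (c - c′) + + sh 2 → Separates c c′
    separates-half {c} {c′} pf q∣ with + n ∣? (c - c′) - + sh 2
    ... | yes n∣ = c , + 2 , cong₂ _-_ (detector-self c) detector-c′-c≡-1 , ∣ᵤ⇒∣ (proj₂ pf)
      where
      detector-c′-c≡-1 : detector c′ c ≡ -1ℤ
      detector-c′-c≡-1 = detectorOn-half (primeFactors-unique n) (primeFactors-sound n) (∈-primeFactors pf) n∣
    ... | no n∤ with ∃-part∤ (n∤ ∘ ∣ᵤ⇒∣)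
    ...   | p , pf′ , q′∤ with p ≟ 2
    ...     | yes refl = contradiction (∣⇒∣ᵤ q∣c-c′-h) q′∤
      where
      add-sub : ∀ z h → (z + h) - (h + h) ≡ z - h
      add-sub = solve-∀
      q∣c-c′-h : + part pf ∣ (c - c′) - + sh 2
      q∣c-c′-h = subst (+ part pf ∣_)
        (trans (cong (λ m → ((c - c′) + + sh 2) - m) (sym (sh2+sh2≡n pf))) (add-sub (c - c′) (+ sh 2)))
        (∣m∣n⇒∣m-n q∣ (part∣n pf ∣-refl))
    ...     | no p≢2 with separates-at pf′ q′∤c-c′
      where
      q′∤c-c′ : ¬ + part pf′ ∣ c - c′
      q′∤c-c′ q′∣ = q′∤ (∣⇒∣ᵤ (∣m∣n⇒∣m-n q′∣ (part∣sh pf′ pf p≢2)))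
    ...       | inj₁ sep = sep
    ...       | inj₂ (p≡2 , _) = contradiction p≡2 p≢2

    separates : ∀ {c c′} → ¬ + n ∣ c - c′ → Separates c c′
    separates n∤ with ∃-part∤ (n∤ ∘ ∣ᵤ⇒∣)
    ... | p , pf , q∤ with separates-at pf (q∤ ∘ ∣⇒∣ᵤ)
    ...   | inj₁ sep = sep
    ...   | inj₂ (refl , q∣) = separates-half pf q∣

module CoveringSystems where

  open import Defs
  open Sums
  open Differences
  open ResidueClasses
  open PrimeParts
  open Detectors
  open import Data.Nat as ℕ using (ℕ; NonZero; _≤_; _≟_)
  import Data.Nat.Properties as ℕ
  import Data.Nat.Divisibility as ℕ
  open import Data.Nat.GCD using (gcd; gcd[m,n]∣m; gcd[m,n]∣n)
  open import Data.Nat.LCM using (lcm; m∣lcm[m,n]; n∣lcm[m,n])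
  open import Data.Integer using (ℤ; +_; _+_; _-_; _*_; -_; 0ℤ; 1ℤ)
  open import Data.Integer.Properties using (+-identityʳ; pos-*)
  open import Data.Integer.Divisibility.Signed using (_∣_; _∣?_; ∣ᵤ⇒∣; ∣-trans; ∣m⇒∣-m; *-monoʳ-∣)
  open import Data.Integer.Tactic.RingSolver using (solve-∀)
  open import Data.Fin using (Fin; zero; suc)
  open import Data.Fin.Properties using (any?; cantor-schröder-bernstein)
  open import Data.List.Membership.Propositional.Properties using (∈-map⁺)
  open import Data.Product using (∃; _×_; _,_; proj₁; proj₂; swap)
  open import Data.Sum using (_⊎_; inj₁; inj₂)
  open import Function using (_∘_)
  open import Function.Bundles using (_⇔_)
  open import Function.Definitions using (Injective)
  open import Relation.Nullary using (Dec; yes; no; ¬_; ¬?; contradiction)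
  open import Relation.Nullary.Decidable using (_×-dec_; decidable-stable)
  open import Relation.Binary.PropositionalEquality hiding (J)

  SameClass : ℤ → ℕ → ℤ → ℕ → Set
  SameClass c d c′ d′ = d ≡ d′ × + d ∣ c - c′

  SameClass-sym : ∀ {c d c′ d′} → SameClass c d c′ d′ → SameClass c′ d′ c d
  SameClass-sym {c} {d} {c′} (d≡d′ , d∣c-c′) =
    sym d≡d′ , subst (λ d → + d ∣ c′ - c) d≡d′ (subst (+ d ∣_) (neg-sub c c′) (∣m⇒∣-m d∣c-c′))
    where
    neg-sub : ∀ u v → - (u - v) ≡ v - u
    neg-sub = solve-∀

  SameClass⇒⇔ : ∀ {c d c′ d′} → SameClass c d c′ d′ → ∀ x → x ∈RC c ⟨ d ⟩ ⇔ x ∈RC c′ ⟨ d′ ⟩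
  SameClass⇒⇔ {c} {d} {c′} (d≡d′ , d∣c-c′) x = subst (λ d′ → x ∈RC c ⟨ d ⟩ ⇔ x ∈RC c′ ⟨ d′ ⟩) d≡d′
    (∈RC-resp {x} {x} (subst (+ d ∣_) (neg-sub x c c′) (∣m⇒∣-m d∣c-c′)))
    where
    neg-sub : ∀ x u v → - (u - v) ≡ (x - u) - (x - v)
    neg-sub = solve-∀

  Occurs : ∀ {l} → (Fin l → ℤ) → (Fin l → ℕ) → ℤ → ℕ → Set
  Occurs {l} b mo c d = ∃ λ t → SameClass c d (b t) (mo t)

  Occurs? : ∀ {l} (b : Fin l → ℤ) (mo : Fin l → ℕ) c d → Dec (Occurs b mo c d)
  Occurs? b mo c d = any? λ t → (d ≟ mo t) ×-dec (+ d ∣? c - b t)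

  max-or-none : ∀ {k} {P : Fin k → Set} → (∀ i → Dec (P i)) → (w : Fin k → ℕ) →
    (∀ i → ¬ P i) ⊎ ∃ λ i → P i × ∀ j → P j → w j ≤ w i
  max-or-none {ℕ.zero}  P? w = inj₁ λ ()
  max-or-none {ℕ.suc k} P? w with max-or-none (P? ∘ suc) (w ∘ suc) | P? zero
  ... | inj₁ none | no ¬P₀ = inj₁ λ { zero → ¬P₀ ; (suc j) → none j }
  ... | inj₁ none | yes P₀ = inj₂ (zero , P₀ , λ { zero _ → ℕ.≤-refl ; (suc j) Pj → contradiction Pj (none j) })
  ... | inj₂ (i , Pi , max) | no ¬P₀ = inj₂ (suc i , Pi , λ { zero P₀ → contradiction P₀ ¬P₀ ; (suc j) → max j })
  ... | inj₂ (i , Pi , max) | yes P₀ with w zero ℕ.≤? w (suc i)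
  ...   | yes w₀≤ = inj₂ (suc i , Pi , λ { zero _ → w₀≤ ; (suc j) → max j })
  ...   | no w₀≰ = inj₂ (zero , P₀ , λ { zero _ → ℕ.≤-refl ; (suc j) Pj → ℕ.≤-trans (max j Pj) (ℕ.≰⇒≥ w₀≰) })

  module Systems {k l} (a : Fin k → ℤ) (n : Fin k → ℕ) (b : Fin l → ℤ) (mo : Fin l → ℕ) where

    Same : Fin k → Fin l → Set
    Same s t = SameClass (a s) (n s) (b t) (mo t)

    Same? : ∀ s t → Dec (Same s t)
    Same? s t = (n s ≟ mo t) ×-dec (+ n s ∣? a s - b t)

    Same⇒indicator : ∀ {s t} → Same s t → indicator (a s) (n s) ≗ indicator (b t) (mo t)
    Same⇒indicator {s} {t} st x = ⟦⟧-cong (x ∈RC? a s ⟨ n s ⟩) (x ∈RC? b t ⟨ mo t ⟩) (SameClass⇒⇔ st x)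

    difference : ℤ → ℤ
    difference x = + cover a n x - + cover b mo x

    IsTop : ℕ → Set
    IsTop d = (∀ s → ¬ Occurs b mo (a s) (n s) → n s ≤ d) × (∀ t → ¬ Occurs a n (b t) (mo t) → mo t ≤ d)

    top-unmatched :
      (∀ s → Occurs b mo (a s) (n s)) × (∀ t → Occurs a n (b t) (mo t))
      ⊎ (∃ λ s₀ → ¬ Occurs b mo (a s₀) (n s₀) × IsTop (n s₀))
      ⊎ (∃ λ t₀ → ¬ Occurs a n (b t₀) (mo t₀) × IsTop (mo t₀))
    top-unmatched with max-or-none (λ s → ¬? (Occurs? b mo (a s) (n s))) n
                     | max-or-none (λ t → ¬? (Occurs? a n (b t) (mo t))) mo
    ... | inj₁ ¬¬inB | inj₁ ¬¬inA = inj₁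
      ( (λ s → decidable-stable (Occurs? b mo (a s) (n s)) (¬¬inB s))
      , (λ t → decidable-stable (Occurs? a n (b t) (mo t)) (¬¬inA t)))
    ... | inj₂ (s₀ , ∉B , maxA) | inj₁ ¬¬inA =
      inj₂ (inj₁ (s₀ , ∉B , maxA , λ t ∉A → contradiction ∉A (¬¬inA t)))
    ... | inj₁ ¬¬inB | inj₂ (t₀ , ∉A , maxB) =
      inj₂ (inj₂ (t₀ , ∉A , (λ s ∉B → contradiction ∉B (¬¬inB s)) , maxB))
    ... | inj₂ (s₀ , ∉B , maxA) | inj₂ (t₀ , ∉A , maxB) with n s₀ ℕ.≤? mo t₀
    ...   | yes ≤ = inj₂ (inj₂ (t₀ , ∉A , (λ s ∉B′ → ℕ.≤-trans (maxA s ∉B′) ≤) , maxB))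
    ...   | no ≰ = inj₂ (inj₁ (s₀ , ∉B , maxA , λ t ∉A′ → ℕ.≤-trans (maxB t ∉A′) (ℕ.≰⇒≥ ≰)))

    coincide : Injective _≡_ _≡_ n → Injective _≡_ _≡_ mo →
      (∀ s → Occurs b mo (a s) (n s)) → (∀ t → Occurs a n (b t) (mo t)) →
      (k ≡ l)
        × (∀ s → ∃ λ t → ∀ x → (x ∈RC a s ⟨ n s ⟩) ⇔ (x ∈RC b t ⟨ mo t ⟩))
        × (∀ t → ∃ λ s → ∀ x → (x ∈RC a s ⟨ n s ⟩) ⇔ (x ∈RC b t ⟨ mo t ⟩))
    coincide injn injmo inB inA =
        cantor-schröder-bernstein {f = proj₁ ∘ inB} {g = proj₁ ∘ inA}
          (λ {s} {s′} e → injn (trans (proj₁ (proj₂ (inB s))) (trans (cong mo e) (sym (proj₁ (proj₂ (inB s′)))))))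
          (λ {t} {t′} e → injmo (trans (proj₁ (proj₂ (inA t))) (trans (cong n e) (sym (proj₁ (proj₂ (inA t′)))))))
      , (λ s → proj₁ (inB s) , SameClass⇒⇔ (proj₂ (inB s)))
      , (λ t → proj₁ (inA t) , SameClass⇒⇔ (SameClass-sym {b t} {mo t} {a (proj₁ (inA t))} (proj₂ (inA t))))

    module UnmatchedTopInA
      (injn : Injective _≡_ _≡_ n) (injmo : Injective _≡_ _≡_ mo)
      (n≢0 : ∀ s → NonZero (n s)) (mo≢0 : ∀ t → NonZero (mo t))
      {N} (n∣N : ∀ s → n s ℕ.∣ N) (mo∣N : ∀ t → mo t ℕ.∣ N)
      (s₀ : Fin k) (s₀∉B : ¬ Occurs b mo (a s₀) (n s₀)) (s₀-top : IsTop (n s₀)) where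

      private
        nn : ℕ
        nn = n s₀
        instance
          nn≢0 : NonZero nn
          nn≢0 = n≢0 s₀
        K : ℕ
        K = ℕ.quotient (n∣N s₀)
        N≡Knn : N ≡ K ℕ.* nn
        N≡Knn = ℕ.m∣n⇒n≡quotient*m (n∣N s₀)
      open Detector nn

      T : (ℤ → ℤ) → ℤ → ℤ
      T φ = Δ* shifts (average K nn φ)

      T-linear : Linear T
      T-linear = ∘-linear (Δ*-linear shifts) (average-linear K nn)

      T-kills : ∀ c d → .{{NonZero d}} → d ≤ nn → d ≢ nn → d ℕ.∣ N → ∀ y → T (indicator c d) y ≡ 0ℤ
      T-kills c d d≤nn d≢nn d∣N with proper-divisor⇒∣cofactor (gcd[m,n]∣m nn d) g≢nn
        where
        g≢nn : gcd nn d ≢ nn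
        g≢nn g≡nn = d≢nn (ℕ.≤-antisym d≤nn (ℕ.∣⇒≤ (subst (ℕ._∣ d) g≡nn (gcd[m,n]∣n nn d))))
      ... | p , pf , g∣sh = Δ*-annihilates (∈-map⁺ sh (∈-primeFactors pf)) (periodic-∣ period-g g∣sh)
        where
        period-g : Periodic (average K nn (indicator c d)) (gcd nn d)
        period-g = periodic-gcd
          (average-periodic-step K nn (indicator-periodic (subst (d ℕ.∣_) N≡Knn d∣N)))
          (average-periodic K nn (indicator-periodic ℕ.∣-refl))

      T-top : ∀ c y → T (indicator c nn) y ≡ + K * detector c y
      T-top c y = trans (Linear.ext (Δ*-linear shifts) (average-of-periodic K nn (indicator-periodic ℕ.∣-refl)) y)
                        (Linear.*-hom (Δ*-linear shifts) (+ K) (indicator c nn) y)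

      private
        I : Fin k → ℤ → ℤ
        I s = indicator (a s) (n s)
        J : Fin l → ℤ → ℤ
        J t = indicator (b t) (mo t)

        unmatchedA : ℤ → Fin k → ℤ
        unmatchedA y s = ⟦ ¬? (any? (Same? s)) ⟧ * T (I s) y
        unmatchedB : ℤ → Fin l → ℤ
        unmatchedB y t = ⟦ ¬? (any? (λ s → Same? s t)) ⟧ * T (J t) y

        Same-functional : ∀ {s t t′} → Same s t → Same s t′ → t ≡ t′
        Same-functional (e , _) (e′ , _) = injmo (trans (sym e) e′)

        Same-injective : ∀ {s s′ t} → Same s t → Same s′ t → s ≡ s′
        Same-injective (e , _) (e′ , _) = injn (trans e (sym e′))

        ∉A : ∀ {t} → ¬ ∃ (λ s → Same s t) → ¬ Occurs a n (b t) (mo t)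
        ∉A {t} ¬∃ (s , st) = ¬∃ (s , SameClass-sym {b t} {mo t} {a s} {n s} st)

        unmatchedB-zero : ∀ y t → mo t ≢ nn → unmatchedB y t ≡ 0ℤ
        unmatchedB-zero y t mo≢nn = ⟦¬?⟧*-zero (any? (λ s → Same? s t)) λ t∉A →
          T-kills (b t) (mo t) {{mo≢0 t}} (proj₂ s₀-top t (∉A t∉A)) mo≢nn (mo∣N t) y

      T-difference : ∀ y → T difference y ≡ ∑[ s < k ] unmatchedA y s - ∑[ t < l ] unmatchedB y t
      T-difference y = begin
        T difference y
          ≡⟨ Linear.ext T-linear (λ x → cong₂ _-_ (cover≡∑indicator a n x) (cover≡∑indicator b mo x)) y ⟩
        T (λ x → ∑[ s < k ] I s x - ∑[ t < l ] J t x) y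
          ≡⟨ Linear.-‿hom T-linear (λ x → ∑[ s < k ] I s x) (λ x → ∑[ t < l ] J t x) y ⟩
        T (λ x → ∑[ s < k ] I s x) y - T (λ x → ∑[ t < l ] J t x) y
          ≡⟨ cong₂ _-_ (Linear.∑-hom T-linear I y) (Linear.∑-hom T-linear J y) ⟩
        ∑[ s < k ] T (I s) y - ∑[ t < l ] T (J t) y
          ≡⟨ ∑-cancel-matched Same? Same-functional Same-injective _ _ (λ st → Linear.ext T-linear (Same⇒indicator st) y) ⟩
        ∑[ s < k ] unmatchedA y s - ∑[ t < l ] unmatchedB y t
          ∎
        where open ≡-Reasoning

      T-unmatchedA : ∀ y → ∑[ s < k ] unmatchedA y s ≡ + K * detector (a s₀) y
      T-unmatchedA y = begin
        ∑[ s < k ] unmatchedA y s  ≡⟨ ∑-single _ s₀ others ⟩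
        unmatchedA y s₀           ≡⟨ ⟦⟧*-yes (¬? (any? (Same? s₀))) s₀∉B (T (I s₀) y) ⟩
        T (I s₀) y                ≡⟨ T-top (a s₀) y ⟩
        + K * detector (a s₀) y   ∎
        where
        open ≡-Reasoning
        others : ∀ s → s ≢ s₀ → unmatchedA y s ≡ 0ℤ
        others s s≢s₀ = ⟦¬?⟧*-zero (any? (Same? s)) λ s∉B →
          T-kills (a s) (n s) {{n≢0 s}} (proj₁ s₀-top s s∉B) (s≢s₀ ∘ injn) (n∣N s) y

      T-unmatchedB : ∀ y {t₀} → mo t₀ ≡ nn → ∑[ t < l ] unmatchedB y t ≡ + K * detector (b t₀) y
      T-unmatchedB y {t₀} mo≡nn = begin
        ∑[ t < l ] unmatchedB y t  ≡⟨ ∑-single _ t₀ others ⟩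
        unmatchedB y t₀           ≡⟨ ⟦⟧*-yes (¬? (any? (λ s → Same? s t₀))) t₀∉A (T (J t₀) y) ⟩
        T (J t₀) y                ≡⟨ cong (λ d → T (indicator (b t₀) d) y) mo≡nn ⟩
        T (indicator (b t₀) nn) y ≡⟨ T-top (b t₀) y ⟩
        + K * detector (b t₀) y   ∎
        where
        open ≡-Reasoning
        others : ∀ t → t ≢ t₀ → unmatchedB y t ≡ 0ℤ
        others t t≢t₀ = unmatchedB-zero y t (t≢t₀ ∘ injmo ∘ λ e → trans e (sym mo≡nn))
        t₀∉A : ¬ ∃ λ s → Same s t₀
        t₀∉A (s , st) = s₀∉B (t₀ , subst (λ s → Same s t₀) (injn (trans (proj₁ st) mo≡nn)) st)

      T-unmatchedB-none : ∀ y → (∀ t → mo t ≢ nn) → ∑[ t < l ] unmatchedB y t ≡ 0ℤ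
      T-unmatchedB-none y none = ∑-zero _ (λ t → unmatchedB-zero y t (none t))

      private
        ∣N : ∀ {m} → (∀ x → m ∣ difference x) → ∀ y v → v ∣ + nn → T difference y ≡ + K * v → m ∣ + N
        ∣N {m} m∣δ y v v∣nn eq = subst (m ∣_) (trans (sym (pos-* K nn)) (cong +_ (sym N≡Knn)))
          (∣-trans (subst (m ∣_) eq (Linear.∣-hom T-linear difference m∣δ y)) (*-monoʳ-∣ (+ K) v∣nn))

      ∣N-of-∣difference : ∀ {m} → (∀ x → m ∣ difference x) → m ∣ + N
      ∣N-of-∣difference m∣δ with any? (λ t → mo t ≟ nn)
      ... | yes (t₀ , mo≡nn) with separates {a s₀} {b t₀} (λ nn∣ → s₀∉B (t₀ , sym mo≡nn , nn∣))
      ...   | y , v , eq , v∣nn = ∣N m∣δ y v v∣nn (begin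
        T difference y                                      ≡⟨ T-difference y ⟩
        ∑[ s < k ] unmatchedA y s - ∑[ t < l ] unmatchedB y t ≡⟨ cong₂ _-_ (T-unmatchedA y) (T-unmatchedB y mo≡nn) ⟩
        + K * detector (a s₀) y - + K * detector (b t₀) y   ≡⟨ factor (+ K) _ _ ⟩
        + K * (detector (a s₀) y - detector (b t₀) y)       ≡⟨ cong (_*_ (+ K)) eq ⟩
        + K * v                                             ∎)
        where
        open ≡-Reasoning
        factor : ∀ k u v → k * u - k * v ≡ k * (u - v)
        factor = solve-∀
      ∣N-of-∣difference m∣δ | no none = ∣N m∣δ (a s₀) 1ℤ (∣ᵤ⇒∣ (ℕ.1∣ nn)) (begin
        T difference (a s₀)                                           ≡⟨ T-difference (a s₀) ⟩
        ∑[ s < k ] unmatchedA (a s₀) s - ∑[ t < l ] unmatchedB (a s₀) t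
          ≡⟨ cong₂ _-_ (T-unmatchedA (a s₀)) (T-unmatchedB-none (a s₀) (λ t e → none (t , e))) ⟩
        + K * detector (a s₀) (a s₀) - 0ℤ                            ≡⟨ +-identityʳ _ ⟩
        + K * detector (a s₀) (a s₀)                                 ≡⟨ cong (_*_ (+ K)) (detector-self (a s₀)) ⟩
        + K * 1ℤ                                                     ∎)
        where open ≡-Reasoning

  ∣lcmFam : ∀ {k} (f : Fin k → ℕ) i → f i ℕ.∣ lcmFam f
  ∣lcmFam f zero    = m∣lcm[m,n] _ _
  ∣lcmFam f (suc i) = ℕ.∣-trans (∣lcmFam (f ∘ suc) i) (n∣lcm[m,n] (f zero) _)

  module _ {k l} (a : Fin k → ℤ) (n : Fin k → ℕ) (b : Fin l → ℤ) (mo : Fin l → ℕ)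
           (injn : Injective _≡_ _≡_ n) (injmo : Injective _≡_ _≡_ mo)
           (n≢0 : ∀ s → NonZero (n s)) (mo≢0 : ∀ t → NonZero (mo t))
           {m} (m∣δ : ∀ x → m ∣ Systems.difference a n b mo x) where

    private
      N : ℕ
      N = lcm (lcmFam n) (lcmFam mo)
      n∣N : ∀ s → n s ℕ.∣ N
      n∣N s = ℕ.∣-trans (∣lcmFam n s) (m∣lcm[m,n] _ _)
      mo∣N : ∀ t → mo t ℕ.∣ N
      mo∣N t = ℕ.∣-trans (∣lcmFam mo t) (n∣lcm[m,n] (lcmFam n) _)
      neg-sub : ∀ u v → - (u - v) ≡ v - u
      neg-sub = solve-∀
    open Systems a n b mo using (IsTop)

    unmatched-top⇒∣lcm :
      (∃ λ s₀ → ¬ Occurs b mo (a s₀) (n s₀) × IsTop (n s₀))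
        ⊎ (∃ λ t₀ → ¬ Occurs a n (b t₀) (mo t₀) × IsTop (mo t₀)) →
      m ∣ + N
    unmatched-top⇒∣lcm (inj₁ (s₀ , s₀∉B , top)) =
      Systems.UnmatchedTopInA.∣N-of-∣difference a n b mo injn injmo n≢0 mo≢0 n∣N mo∣N s₀ s₀∉B top m∣δ
    unmatched-top⇒∣lcm (inj₂ (t₀ , t₀∉A , top)) =
      Systems.UnmatchedTopInA.∣N-of-∣difference b mo a n injmo injn mo≢0 n≢0 mo∣N n∣N t₀ t₀∉A (swap top)
        (λ x → subst (m ∣_) (neg-sub (+ cover a n x) (+ cover b mo x)) (∣m⇒∣-m (m∣δ x)))

open import Defs
open import Data.Nat as ℕ using (ℕ; NonZero)
open import Data.Nat.LCM using (lcm)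
open import Data.Integer using (ℤ; +_; _-_)
open import Data.Integer.Divisibility using (_∣_)
open import Data.Fin using (Fin)
open import Data.Product using (_×_; ∃)
open import Function.Definitions using (Injective)
open import Function.Bundles using (_⇔_)
open import Relation.Binary.PropositionalEquality using (_≡_)
open import Relation.Nullary using (¬_)

open import Data.Integer.Divisibility.Signed using (∣ᵤ⇒∣; ∣⇒∣ᵤ)
open import Data.Product using (_,_)
open import Data.Sum using (inj₁; inj₂)
open import Function using (_∘_)
open import Relation.Nullary using (contradiction)
open CoveringSystems using (module Systems; unmatched-top⇒∣lcm)

theorem1p2 : (k l : ℕ) → .{{NonZero k}} → .{{NonZero l}}
  → (a : Fin k → ℤ) (n : Fin k → ℕ) (b : Fin l → ℤ) (mo : Fin l → ℕ)
  → (∀ s → NonZero (n s)) → (∀ t → NonZero (mo t))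
  → Injective _≡_ _≡_ n → Injective _≡_ _≡_ mo
  → (m : ℤ) → ¬ (m ∣ (+ lcm (lcmFam n) (lcmFam mo)))
  → (∀ x → m ∣ ((+ cover a n x) - (+ cover b mo x)))
  → (k ≡ l)
    × (∀ s → ∃ λ t → ∀ x → (x ∈RC a s ⟨ n s ⟩) ⇔ (x ∈RC b t ⟨ mo t ⟩))
    × (∀ t → ∃ λ s → ∀ x → (x ∈RC a s ⟨ n s ⟩) ⇔ (x ∈RC b t ⟨ mo t ⟩))
theorem1p2 k l a n b mo n≢0 mo≢0 injn injmo m m∤N m∣f with Systems.top-unmatched a n b mo
... | inj₁ (inB , inA) = Systems.coincide a n b mo injn injmo inB inA
... | inj₂ top =
  contradiction (∣⇒∣ᵤ (unmatched-top⇒∣lcm a n b mo injn injmo n≢0 mo≢0 (∣ᵤ⇒∣ {m} ∘ m∣f) top)) m∤N
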